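{- Let $\mathbf S=(S,\leq,*,1)$ be a strong skew Hilbert algebra and $M\subseteq S$ a subset with $1\in M$ such that $(x*(y*c))*c\in M$ for all $x,y\in M$ and all $c\in S$. Then $M$ is a deductive system of $\mathbf S$.
   Context: For a poset and a subset $A$, $L(A)$, $U(A)$ are the sets of lower and upper bounds; $L(U(x,y),z)=L(U(\{x,y\})\cup\{z\})$. A skew Hilbert algebra is a poset $(S,\leq,*,1)$ with binary operation $*$ and constant $1$ such that for all $x,y,z$: (S1) $x\leq y$ iff $x*y=1$; (S2) if $y*x=1$ then $x*((x*y)*y)=1$; (S3) if $x*y=1$ then $(y*z)*(x*z)=1$; (S4) $L(U(x,y),x*y)=L(y)$; it is strong if $x*((x*y)*y)=1$ for all $x,y$. A deductive system of $\mathbf S$ is a subset $D\subseteq S$ containing $1$ such that $a\in D$, $b\in S$ and $a*b\in D$ imply $b\in D$. -}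

module Defs where

open import Level using (Level; _⊔_; suc)
open import Data.Product using (_×_)
open import Relation.Binary.PropositionalEquality using (_≡_)
open import Relation.Binary.Structures using (IsPartialOrder)
open import Function.Bundles using (_⇔_)

UpperBound₂ : ∀ {a ℓ} {S : Set a} → (S → S → Set ℓ) → S → S → S → Set ℓ
UpperBound₂ _≤_ x y u = (x ≤ u) × (y ≤ u)

-- L(U(x,y), z) = L(U({x,y}) ∪ {z}) : lower bounds of all upper bounds of {x,y} and of z
LUz : ∀ {a ℓ} {S : Set a} → (S → S → Set ℓ) → S → S → S → S → Set (a ⊔ ℓ)
LUz _≤_ x y z w = (∀ u → UpperBound₂ _≤_ x y u → w ≤ u) × (w ≤ z)

record SkewHilbertAlgebra (a ℓ : Level) : Set (suc (a ⊔ ℓ)) where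
  field
    S      : Set a
    _≤_    : S → S → Set ℓ
    isPO   : IsPartialOrder _≡_ _≤_
    _*_    : S → S → S
    𝟙      : S
    S1 : ∀ x y → (x ≤ y) ⇔ (x * y ≡ 𝟙)
    S2 : ∀ x y → y * x ≡ 𝟙 → x * ((x * y) * y) ≡ 𝟙
    S3 : ∀ x y z → x * y ≡ 𝟙 → (y * z) * (x * z) ≡ 𝟙
    S4 : ∀ x y w → LUz _≤_ x y (x * y) w ⇔ (w ≤ y)

  infixr 5 _*_

IsStrong : ∀ {a ℓ} → SkewHilbertAlgebra a ℓ → Set a
IsStrong 𝐒 = ∀ x y → x * ((x * y) * y) ≡ 𝟙
  where open SkewHilbertAlgebra 𝐒

IsDeductiveSystem : ∀ {a ℓ p} (𝐒 : SkewHilbertAlgebra a ℓ) →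
  (SkewHilbertAlgebra.S 𝐒 → Set p) → Set (a ⊔ p)
IsDeductiveSystem 𝐒 D = D 𝟙 × (∀ x y → D x → D (x * y) → D y)
  where open SkewHilbertAlgebra 𝐒

-- In a strong algebra 1 * b = b: strongness gives b ≤ (b * b) * b = 1 * b and 1 ≤ (1 * b) * b,
-- while (S3) applied to b ≤ 1 * b gives (1 * b) * b ≤ b * b = 1. Hence the closure hypothesis
-- with y := x * y and c := y yields M ((x * ((x * y) * y)) * y) = M (1 * y) = M y.
module Submission where

open import Defs
open import Relation.Binary.PropositionalEquality using (_≡_; sym; subst)
open import Relation.Binary.Structures using (IsPartialOrder)
open import Function.Bundles using (Equivalence)
open import Data.Product using (_,_)

module SkewHilbertAlgebraProperties {a ℓ} (𝐒 : SkewHilbertAlgebra a ℓ) where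
  open SkewHilbertAlgebra 𝐒
  open IsPartialOrder isPO using (antisym) renaming (refl to ≤-refl)

  ≤⇒*≡𝟙 : ∀ {x y} → x ≤ y → x * y ≡ 𝟙
  ≤⇒*≡𝟙 {x} {y} = Equivalence.to (S1 x y)

  *≡𝟙⇒≤ : ∀ {x y} → x * y ≡ 𝟙 → x ≤ y
  *≡𝟙⇒≤ {x} {y} = Equivalence.from (S1 x y)

  *-self : ∀ x → x * x ≡ 𝟙
  *-self x = ≤⇒*≡𝟙 ≤-refl

  *-antitoneˡ-≤ : ∀ {x y} z → x ≤ y → (y * z) ≤ (x * z)
  *-antitoneˡ-≤ {x} {y} z x≤y = *≡𝟙⇒≤ (S3 x y z (≤⇒*≡𝟙 x≤y))

  module Strong (strong : IsStrong 𝐒) where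

    ≤-*-* : ∀ x y → x ≤ ((x * y) * y)
    ≤-*-* x y = *≡𝟙⇒≤ (strong x y)

    ≤-𝟙-* : ∀ b → b ≤ (𝟙 * b)
    ≤-𝟙-* b = subst (λ t → b ≤ (t * b)) (*-self b) (≤-*-* b b)

    𝟙-*-≡𝟙 : ∀ b → (𝟙 * b) * b ≡ 𝟙
    𝟙-*-≡𝟙 b = antisym (subst (((𝟙 * b) * b) ≤_) (*-self b) (*-antitoneˡ-≤ b (≤-𝟙-* b)))
                       (≤-*-* 𝟙 b)

    𝟙-*-identity : ∀ b → 𝟙 * b ≡ b
    𝟙-*-identity b = antisym (*≡𝟙⇒≤ (𝟙-*-≡𝟙 b)) (≤-𝟙-* b)

    *-*-*-identity : ∀ x y → (x * ((x * y) * y)) * y ≡ y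
    *-*-*-identity x y = subst (λ t → t * y ≡ y) (sym (strong x y)) (𝟙-*-identity y)

mainTheorem16 : ∀ {a ℓ p} (𝐒 : SkewHilbertAlgebra a ℓ) → IsStrong 𝐒 →
    (M : SkewHilbertAlgebra.S 𝐒 → Set p) →
    M (SkewHilbertAlgebra.𝟙 𝐒) →
    (∀ x y c → M x → M y →
    M (SkewHilbertAlgebra._*_ 𝐒 (SkewHilbertAlgebra._*_ 𝐒 x (SkewHilbertAlgebra._*_ 𝐒 y c)) c)) →
    IsDeductiveSystem 𝐒 M
mainTheorem16 𝐒 strong M M𝟙 closed = M𝟙 , modusPonens
  where
  open SkewHilbertAlgebra 𝐒
  open SkewHilbertAlgebraProperties.Strong 𝐒 strong

  modusPonens : ∀ x y → M x → M (x * y) → M y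
  modusPonens x y Mx Mx*y = subst M (*-*-*-identity x y) (closed x (x * y) y Mx Mx*y)
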